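{- Let $a\in\mathbb{N}$. Then $a$ is a Fibonacci number of even index if and only if $\{\varphi a\}$ is the minimum of the set $\{\{\varphi n\}: n\in\mathbb{Z},\ 0<n\le a\}$; and $a$ is a Fibonacci number of odd index if and only if $\{\varphi a\}$ is the maximum of that set.
   Context: $\varphi=(1+\sqrt5)/2$ is the golden ratio and $\{t\}=t-\lfloor t\rfloor$ denotes the fractional part. The Fibonacci numbers are $F_0=F_1=1$, $F_{n+2}=F_n+F_{n+1}$; "$a$ is a Fibonacci number of even (odd) index" means $a=F_{2k}$ ($a=F_{2k+1}$) for some $k\ge0$. -}

module Defs where

open import Data.Nat using (ℕ; zero; suc)
import Data.Nat as ℕ
open import Data.Integer using (ℤ; +_; _+_; _-_; _*_; -_; _≤_; _<_)
open import Data.Product using (Σ; _×_; ∃-syntax)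
open import Data.Sum using (_⊎_)
open import Relation.Binary.PropositionalEquality using (_≡_)

-- Fibonacci numbers with the paper's convention F₀ = F₁ = 1.
fib : ℕ → ℕ
fib zero = 1
fib (suc zero) = 1
fib (suc (suc n)) = fib n ℕ.+ fib (suc n)

EvenIndexFib : ℕ → Set
EvenIndexFib a = ∃[ k ] a ≡ fib (2 ℕ.* k)

OddIndexFib : ℕ → Set
OddIndexFib a = ∃[ k ] a ≡ fib (suc (2 ℕ.* k))

-- Exact real numbers of the form  a + b·φ  (a, b ∈ ℤ), φ = (1+√5)/2.
record ℤ[φ] : Set where
  constructor _+_φ
  field
    re : ℤ
    im : ℤ
open ℤ[φ] public

_-φ_ : ℤ[φ] → ℤ[φ] → ℤ[φ]
(a + b φ) -φ (c + d φ) = (a - c) + (b - d) φ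

-- a + bφ ≥ 0  ⟺  x + y√5 ≥ 0 where x = 2a+b, y = b.
NonNeg : ℤ[φ] → Set
NonNeg (a + b φ) =
    (+ 0 ≤ x × + 0 ≤ y)
  ⊎ ((+ 0 ≤ x × y < + 0) × (+ 5 * (y * y) ≤ x * x))
  ⊎ ((x < + 0 × + 0 < y) × (x * x ≤ + 5 * (y * y)))
  where
  x = (+ 2 * a) + b
  y = b

_≤φ_ : ℤ[φ] → ℤ[φ] → Set
u ≤φ v = NonNeg (v -φ u)

_<φ_ : ℤ[φ] → ℤ[φ] → Set
u <φ v = u ≤φ v × (v ≤φ u → Data.Empty.⊥)
  where import Data.Empty

φ*_-_ : ℕ → ℤ → ℤ[φ]
φ* n - m = (- m) + (+ n) φ

IsFloorφ : ℕ → ℤ → Set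
IsFloorφ n m = ((+ 0) + (+ 0) φ) ≤φ (φ* n - m) × (φ* n - m) <φ ((+ 1) + (+ 0) φ)

fracφ : (ℕ → ℤ) → ℕ → ℤ[φ]
fracφ fl n = φ* n - fl n

IsMinFrac : (ℕ → ℤ) → ℕ → Set
IsMinFrac fl a = (1 ℕ.≤ a) × (∀ n → 1 ℕ.≤ n → n ℕ.≤ a → fracφ fl a ≤φ fracφ fl n)

IsMaxFrac : (ℕ → ℤ) → ℕ → Set
IsMaxFrac fl a = (1 ℕ.≤ a) × (∀ n → 1 ℕ.≤ n → n ℕ.≤ a → fracφ fl n ≤φ fracφ fl a)

-- Multiplication by φ and by
-- φ⁻¹ = φ - 1 preserves NonNeg, hence so does multiplication by φ^(k+2) = F (k+1) φ + F k.
-- For 1 ≤ n < F (k+2) write φ^(k+2) (φ n - m) = c + d φ. Cassini's identity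
-- F k F (k+2) - F (k+1)² = (-1)^k gives d F k - c F (k+1) = (-1)^k n, and as 0 < n < F k + F (k+1)
-- the pair ±(c, d) has c < 0, d ≤ 0 or c ≥ 0, d ≥ 1. For even k and m = ⌊φ n⌋ the first option
-- contradicts φ n - m ≥ 0, and the second says φ^(k+2) (φ n - m) ≥ φ = φ^(k+2) (φ F k - F (k+1)),
-- with equality only if n = F k; so F (k+1) = ⌊φ F k⌋ and {φ F k} < {φ n} for the other n.
-- Odd k is symmetric, with ⌊φ n⌋ + 1 in place of ⌊φ n⌋. The converse holds because every a ≥ 1
-- lies in some [F k, F (k+2)) with k of either parity.
module Submission where

open import Data.Empty using (⊥-elim)
open import Data.Integer
  using ( ℤ; +_; -[1+_]; 0ℤ; 1ℤ; _+_; _-_; _*_; -_; _≤_; _<_; +≤+; +<+; -≤+; -<+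
        ; positive; nonNegative)
open import Data.Integer.Properties
open import Data.Integer.Tactic.RingSolver using (solve-∀)
open import Data.Nat using (ℕ; zero; suc; z≤n; s≤s)
import Data.Nat as ℕ
import Data.Nat.Properties as ℕₚ
open import Data.Product using (_×_; _,_; proj₁; proj₂; ∃-syntax)
open import Data.Sum using (_⊎_; inj₁; inj₂)
open import Function.Bundles using (_⇔_; mk⇔; Equivalence)
open import Function.Properties.Equivalence using () renaming (refl to ⇔-refl; trans to ⇔-trans)
open import Relation.Binary.PropositionalEquality
open import Relation.Nullary using (¬_; yes; no)

open import Defs

open Equivalence

private variable
  i j x y x′ y′ : ℤ

0≤⊎<0 : ∀ i → 0ℤ ≤ i ⊎ i < 0ℤ
0≤⊎<0 (+ n) = inj₁ (+≤+ z≤n)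
0≤⊎<0 -[1+ n ] = inj₂ -<+

*-nonNeg : 0ℤ ≤ i → 0ℤ ≤ j → 0ℤ ≤ i * j
*-nonNeg {j = j} 0≤i 0≤j = *-monoʳ-≤-nonNeg j {{nonNegative 0≤j}} 0≤i

i<j⇒0<j-i : i < j → 0ℤ < j - i
i<j⇒0<j-i {i} {j} i<j = subst (_< j - i) (+-inverseʳ i) (+-monoˡ-< (- i) i<j)

i<j⇒i-j<0 : i < j → i - j < 0ℤ
i<j⇒i-j<0 {i} {j} i<j = subst (i - j <_) (+-inverseʳ j) (+-monoˡ-< (- j) i<j)

i-j<0⇒i<j : i - j < 0ℤ → i < j
i-j<0⇒i<j {i} {j} i-j<0 = subst₂ _<_ (ring i j) (+-identityˡ j) (+-monoˡ-< j i-j<0)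
  where
  ring : ∀ i j → i - j + j ≡ i
  ring = solve-∀

halve-nonNeg : + 2 * i ≡ j → 0ℤ ≤ j → 0ℤ ≤ i
halve-nonNeg {i} refl = *-cancelˡ-≤-pos 0ℤ i (+ 2)

halve-pos : + 2 * i ≡ j → 0ℤ < j → 0ℤ < i
halve-pos refl = *-cancelˡ-<-nonNeg (+ 2)

halve-neg : + 2 * i ≡ j → j < 0ℤ → i < 0ℤ
halve-neg refl = *-cancelˡ-<-nonNeg (+ 2)

double-neg : + 2 * i ≡ j → i < 0ℤ → j < 0ℤ
double-neg refl = *-monoˡ-<-pos (+ 2)

i≤5*i : 0ℤ ≤ i → i ≤ + 5 * i
i≤5*i {i} 0≤i = subst (_≤ + 5 * i) (*-identityˡ i) (*-monoʳ-≤-nonNeg i {{nonNegative 0≤i}} 1≤5)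
  where
  1≤5 : 1ℤ ≤ + 5
  1≤5 = +≤+ (s≤s z≤n)

i<5*i : 0ℤ < i → i < + 5 * i
i<5*i {i} 0<i = subst (_< + 5 * i) (*-identityˡ i) (*-monoʳ-<-pos i {{positive 0<i}} 1<5)
  where
  1<5 : 1ℤ < + 5
  1<5 = +<+ (s≤s (s≤s z≤n))

square-mono-≤ : 0ℤ ≤ i → i ≤ j → i * i ≤ j * j
square-mono-≤ {i} {j} 0≤i i≤j = begin
  i * i ≤⟨ *-monoʳ-≤-nonNeg i {{nonNegative 0≤i}} i≤j ⟩
  j * i ≤⟨ *-monoˡ-≤-nonNeg j {{nonNegative (≤-trans 0≤i i≤j)}} i≤j ⟩
  j * j ∎
  where open ≤-Reasoning

square-mono-< : 0ℤ ≤ i → i < j → i * i < j * j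
square-mono-< {i} {j} 0≤i i<j = begin-strict
  i * i ≤⟨ *-monoʳ-≤-nonNeg i {{nonNegative 0≤i}} (<⇒≤ i<j) ⟩
  j * i <⟨ *-monoˡ-<-pos j {{positive (≤-<-trans 0≤i i<j)}} i<j ⟩
  j * j ∎
  where open ≤-Reasoning

neg-square : ∀ i → - i * - i ≡ i * i
neg-square = solve-∀

square<5*square : 0ℤ ≤ i → i ≤ j → 0ℤ < j → i * i < + 5 * (j * j)
square<5*square 0≤i i≤j 0<j =
  ≤-<-trans (square-mono-≤ 0≤i i≤j) (i<5*i (square-mono-< ≤-refl 0<j))

5*square<square : 0ℤ ≤ j → + 5 * j < i → + 5 * (j * j) < i * i
5*square<square {j} {i} 0≤j 5j<i = begin-strict
  + 5 * (j * j)         ≤⟨ i≤5*i (*-nonNeg {+ 5} (+≤+ z≤n) (*-nonNeg 0≤j 0≤j)) ⟩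
  + 5 * (+ 5 * (j * j)) ≡⟨ ring j ⟩
  (+ 5 * j) * (+ 5 * j) <⟨ square-mono-< (*-nonNeg {+ 5} (+≤+ z≤n) 0≤j) 5j<i ⟩
  i * i                 ∎
  where
  open ≤-Reasoning
  ring : ∀ j → + 5 * (+ 5 * (j * j)) ≡ (+ 5 * j) * (+ 5 * j)
  ring = solve-∀

-- The sign of x + y √5

-- NonNeg (a + b φ) is by definition NonNeg√5 (2a + b) b.
NonNeg√5 : ℤ → ℤ → Set
NonNeg√5 x y =
    (0ℤ ≤ x × 0ℤ ≤ y)
  ⊎ ((0ℤ ≤ x × y < 0ℤ) × (+ 5 * (y * y) ≤ x * x))
  ⊎ ((x < 0ℤ × 0ℤ < y) × (x * x ≤ + 5 * (y * y)))

nonNeg√5-mono : x ≤ x′ → NonNeg√5 x y → NonNeg√5 x′ y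
nonNeg√5-mono x≤x′ (inj₁ (0≤x , 0≤y)) = inj₁ (≤-trans 0≤x x≤x′ , 0≤y)
nonNeg√5-mono x≤x′ (inj₂ (inj₁ ((0≤x , y<0) , 5y²≤x²))) =
  inj₂ (inj₁ ((≤-trans 0≤x x≤x′ , y<0) , ≤-trans 5y²≤x² (square-mono-≤ 0≤x x≤x′)))
nonNeg√5-mono {x} {x′} x≤x′ (inj₂ (inj₂ ((x<0 , 0<y) , x²≤5y²))) with 0≤⊎<0 x′
... | inj₁ 0≤x′ = inj₁ (0≤x′ , <⇒≤ 0<y)
... | inj₂ x′<0 = inj₂ (inj₂ ((x′<0 , 0<y) , ≤-trans x′²≤x² x²≤5y²))
  where
  x′²≤x² : x′ * x′ ≤ x * x
  x′²≤x² = subst₂ _≤_ (neg-square x′) (neg-square x)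
                     (square-mono-≤ (neg-mono-≤ (<⇒≤ x′<0)) (neg-mono-≤ x≤x′))

5y²≤x²⇒0<x+y : 0ℤ ≤ x → y < 0ℤ → + 5 * (y * y) ≤ x * x → 0ℤ < x + y
5y²≤x²⇒0<x+y {x} {y} 0≤x y<0 5y²≤x² with x ≤? - y
... | yes x≤-y = ⊥-elim (<⇒≱ (subst (λ t → x * x < + 5 * t) (neg-square y) x²<5y²) 5y²≤x²)
  where x²<5y² = square<5*square 0≤x x≤-y (neg-mono-< y<0)
... | no x≰-y = subst (0ℤ <_) (cong (λ t → x + t) (neg-involutive y)) (i<j⇒0<j-i (≰⇒> x≰-y))

x²≤5y²⇒0≤x+5y : x < 0ℤ → 0ℤ < y → x * x ≤ + 5 * (y * y) → 0ℤ ≤ x + + 5 * y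
x²≤5y²⇒0≤x+5y {x} {y} x<0 0<y x²≤5y² with - x ≤? + 5 * y
... | yes -x≤5y = subst (0ℤ ≤_) (ring x y) (i≤j⇒0≤j-i -x≤5y)
  where
  ring : ∀ x y → + 5 * y - - x ≡ x + + 5 * y
  ring = solve-∀
... | no -x≰5y = ⊥-elim (<⇒≱ (subst (+ 5 * (y * y) <_) (neg-square x) 5y²<x²) x²≤5y²)
  where 5y²<x² = 5*square<square (<⇒≤ 0<y) (≰⇒> -x≰5y)

norm : ℤ → ℤ → ℤ
norm x y = x * x - + 5 * (y * y)

norm-double : ∀ x y → norm (+ 2 * x) (+ 2 * y) ≡ + 4 * norm x y
norm-double = ring
  where
  ring : ∀ x y → (+ 2 * x) * (+ 2 * x) - + 5 * ((+ 2 * y) * (+ 2 * y)) ≡ + 4 * (x * x - + 5 * (y * y))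
  ring = solve-∀

-- A data type rather than a definition, so that x, y, x′, y′ can be inferred from it.
data OppositeNorms (x y x′ y′ : ℤ) : Set where
  opposite : norm x y ≡ - norm x′ y′ → OppositeNorms x y x′ y′

oppositeNorms-≥⇒≤ : OppositeNorms x y x′ y′ →
                    + 5 * (y * y) ≤ x * x → x′ * x′ ≤ + 5 * (y′ * y′)
oppositeNorms-≥⇒≤ (opposite e) 5y²≤x² =
  i-j≤0⇒i≤j (neg-cancel-≤ {0ℤ} (subst (0ℤ ≤_) e (i≤j⇒0≤j-i 5y²≤x²)))

oppositeNorms-≤⇒≥ : OppositeNorms x y x′ y′ →
                    x * x ≤ + 5 * (y * y) → + 5 * (y′ * y′) ≤ x′ * x′
oppositeNorms-≤⇒≥ (opposite e) x²≤5y² =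
  0≤i-j⇒j≤i (neg-cancel-≤ {_} {0ℤ} (subst (_≤ 0ℤ) e (i≤j⇒i-j≤0 x²≤5y²)))

-- x′ + y′ √5 = φ (x + y √5)
module _ {x y x′ y′ : ℤ} (h₁ : + 2 * x′ ≡ x + + 5 * y) (h₂ : + 2 * y′ ≡ x + y) where

  oppositeNorms-mulφ : OppositeNorms x y x′ y′
  oppositeNorms-mulφ = opposite (*-cancelˡ-≡ (+ 4) _ _ (begin
    + 4 * norm x y               ≡⟨ ring x y ⟩
    - norm (x + + 5 * y) (x + y) ≡⟨ cong₂ (λ s t → - norm s t) h₁ h₂ ⟨
    - norm (+ 2 * x′) (+ 2 * y′) ≡⟨ cong -_ (norm-double x′ y′) ⟩
    - (+ 4 * norm x′ y′)         ≡⟨ neg-distribʳ-* (+ 4) _ ⟩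
    + 4 * - norm x′ y′           ∎))
    where
    open ≡-Reasoning
    ring : ∀ x y → + 4 * (x * x - + 5 * (y * y))
                 ≡ - ((x + + 5 * y) * (x + + 5 * y) - + 5 * ((x + y) * (x + y)))
    ring = solve-∀

  nonNeg√5-mulφ : NonNeg√5 x y → NonNeg√5 x′ y′
  nonNeg√5-mulφ (inj₁ (0≤x , 0≤y)) =
    inj₁ ( halve-nonNeg h₁ (+-mono-≤ 0≤x (*-nonNeg {+ 5} (+≤+ z≤n) 0≤y))
         , halve-nonNeg h₂ (+-mono-≤ 0≤x 0≤y))
  nonNeg√5-mulφ (inj₂ (inj₁ ((0≤x , y<0) , 5y²≤x²))) = by-sign (0≤⊎<0 x′)
    where
    0<y′ : 0ℤ < y′
    0<y′ = halve-pos h₂ (5y²≤x²⇒0<x+y 0≤x y<0 5y²≤x²)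
    by-sign : 0ℤ ≤ x′ ⊎ x′ < 0ℤ → NonNeg√5 x′ y′
    by-sign (inj₁ 0≤x′) = inj₁ (0≤x′ , <⇒≤ 0<y′)
    by-sign (inj₂ x′<0) =
      inj₂ (inj₂ ((x′<0 , 0<y′) , oppositeNorms-≥⇒≤ oppositeNorms-mulφ 5y²≤x²))
  nonNeg√5-mulφ (inj₂ (inj₂ ((x<0 , 0<y) , x²≤5y²))) = by-sign (0≤⊎<0 y′)
    where
    0≤x′ : 0ℤ ≤ x′
    0≤x′ = halve-nonNeg h₁ (x²≤5y²⇒0≤x+5y x<0 0<y x²≤5y²)
    by-sign : 0ℤ ≤ y′ ⊎ y′ < 0ℤ → NonNeg√5 x′ y′
    by-sign (inj₁ 0≤y′) = inj₁ (0≤x′ , 0≤y′)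
    by-sign (inj₂ y′<0) =
      inj₂ (inj₁ ((0≤x′ , y′<0) , oppositeNorms-≤⇒≥ oppositeNorms-mulφ x²≤5y²))

-- x + y √5 = φ⁻¹ (x′ + y′ √5)
module _ {x y x′ y′ : ℤ} (g₁ : + 2 * x ≡ + 5 * y′ - x′) (g₂ : + 2 * y ≡ x′ - y′) where

  oppositeNorms-mulφ⁻¹ : OppositeNorms x′ y′ x y
  oppositeNorms-mulφ⁻¹ = opposite (*-cancelˡ-≡ (+ 4) _ _ (begin
    + 4 * norm x′ y′                 ≡⟨ ring x′ y′ ⟩
    - norm (+ 5 * y′ - x′) (x′ - y′) ≡⟨ cong₂ (λ s t → - norm s t) g₁ g₂ ⟨
    - norm (+ 2 * x) (+ 2 * y)       ≡⟨ cong -_ (norm-double x y) ⟩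
    - (+ 4 * norm x y)               ≡⟨ neg-distribʳ-* (+ 4) _ ⟩
    + 4 * - norm x y                 ∎))
    where
    open ≡-Reasoning
    ring : ∀ x′ y′ → + 4 * (x′ * x′ - + 5 * (y′ * y′))
                   ≡ - ((+ 5 * y′ - x′) * (+ 5 * y′ - x′) - + 5 * ((x′ - y′) * (x′ - y′)))
    ring = solve-∀

  nonNeg√5-mulφ⁻¹ : NonNeg√5 x′ y′ → NonNeg√5 x y
  nonNeg√5-mulφ⁻¹ (inj₁ (0≤x′ , 0≤y′)) = by-sign (0≤⊎<0 x) (0≤⊎<0 y)
    where
    by-sign : 0ℤ ≤ x ⊎ x < 0ℤ → 0ℤ ≤ y ⊎ y < 0ℤ → NonNeg√5 x y
    by-sign (inj₁ 0≤x) (inj₁ 0≤y) = inj₁ (0≤x , 0≤y)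
    by-sign (inj₂ x<0) (inj₁ _) =
      inj₂ (inj₂ ((x<0 , 0<y) , oppositeNorms-≥⇒≤ oppositeNorms-mulφ⁻¹ (<⇒≤ 5y′²<x′²)))
      where
      5y′<x′ = i-j<0⇒i<j (double-neg g₁ x<0)
      0<y = halve-pos g₂ (i<j⇒0<j-i (≤-<-trans (i≤5*i 0≤y′) 5y′<x′))
      5y′²<x′² = 5*square<square 0≤y′ 5y′<x′
    by-sign _ (inj₂ y<0) =
      inj₂ (inj₁ ((0≤x , y<0) , oppositeNorms-≤⇒≥ oppositeNorms-mulφ⁻¹ (<⇒≤ x′²<5y′²)))
      where
      x′<y′ = i-j<0⇒i<j (double-neg g₂ y<0)
      0<y′ = ≤-<-trans 0≤x′ x′<y′
      0≤x = halve-nonNeg g₁ (i≤j⇒0≤j-i (≤-trans (<⇒≤ x′<y′) (i≤5*i 0≤y′)))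
      x′²<5y′² = square<5*square 0≤x′ (<⇒≤ x′<y′) 0<y′
  nonNeg√5-mulφ⁻¹ (inj₂ (inj₁ ((0≤x′ , y′<0) , 5y′²≤x′²))) =
    inj₂ (inj₂ ((halve-neg g₁ (i<j⇒i-j<0 (<-≤-trans (*-monoˡ-<-pos (+ 5) y′<0) 0≤x′))
               , halve-pos g₂ (i<j⇒0<j-i (<-≤-trans y′<0 0≤x′)))
               , oppositeNorms-≥⇒≤ oppositeNorms-mulφ⁻¹ 5y′²≤x′²))
  nonNeg√5-mulφ⁻¹ (inj₂ (inj₂ ((x′<0 , 0<y′) , x′²≤5y′²))) =
    inj₂ (inj₁ ((halve-nonNeg g₁ (<⇒≤ (i<j⇒0<j-i (<-trans x′<0 (*-monoˡ-<-pos (+ 5) 0<y′))))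
               , halve-neg g₂ (i<j⇒i-j<0 (<-trans x′<0 0<y′)))
               , oppositeNorms-≤⇒≥ oppositeNorms-mulφ⁻¹ x′²≤5y′²))

private variable
  a a′ b : ℤ

mulφ : ℤ[φ] → ℤ[φ]
mulφ (a + b φ) = b + (a + b) φ

nonNeg-mulφ : ∀ u → NonNeg u ⇔ NonNeg (mulφ u)
nonNeg-mulφ (a + b φ) =
  mk⇔ (nonNeg√5-mulφ (2x′≡x+5y a b) (2y′≡x+y a b))
      (nonNeg√5-mulφ⁻¹ (2x≡5y′-x′ a b) (2y≡x′-y′ a b))
  where
  2x′≡x+5y : ∀ a b → + 2 * (+ 2 * b + (a + b)) ≡ (+ 2 * a + b) + + 5 * b
  2x′≡x+5y = solve-∀
  2y′≡x+y : ∀ a b → + 2 * (a + b) ≡ (+ 2 * a + b) + b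
  2y′≡x+y = solve-∀
  2x≡5y′-x′ : ∀ a b → + 2 * (+ 2 * a + b) ≡ + 5 * (a + b) - (+ 2 * b + (a + b))
  2x≡5y′-x′ = solve-∀
  2y≡x′-y′ : ∀ a b → + 2 * b ≡ (+ 2 * b + (a + b)) - (a + b)
  2y≡x′-y′ = solve-∀

nonNeg-coords : ∀ u → 0ℤ ≤ re u → 0ℤ ≤ im u → NonNeg u
nonNeg-coords _ 0≤a 0≤b = inj₁ (+-mono-≤ (*-nonNeg {+ 2} (+≤+ z≤n) 0≤a) 0≤b , 0≤b)

nonNeg-nonPos-coords : ∀ u → re u ≤ 0ℤ → im u ≤ 0ℤ → NonNeg u →
                       re u ≡ 0ℤ × im u ≡ 0ℤ
nonNeg-nonPos-coords (a + b φ) a≤0 b≤0 (inj₁ (0≤2a+b , 0≤b)) with ≤-antisym b≤0 0≤b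
... | refl = ≤-antisym a≤0 (halve-nonNeg refl (subst (0ℤ ≤_) (+-identityʳ (+ 2 * a)) 0≤2a+b)) , refl
nonNeg-nonPos-coords _ a≤0 b≤0 (inj₂ (inj₁ ((0≤2a+b , b<0) , _))) =
  ⊥-elim (<⇒≱ (+-mono-≤-< (*-monoˡ-≤-nonNeg (+ 2) a≤0) b<0) 0≤2a+b)
nonNeg-nonPos-coords _ a≤0 b≤0 (inj₂ (inj₂ ((_ , 0<b) , _))) = ⊥-elim (<⇒≱ 0<b b≤0)

nonNeg-rational : NonNeg (a + 0ℤ φ) → 0ℤ ≤ a
nonNeg-rational {a} a≥0 with 0≤⊎<0 a
... | inj₁ 0≤a = 0≤a
... | inj₂ a<0 =
  ⊥-elim (<-irrefl (proj₁ (nonNeg-nonPos-coords (a + 0ℤ φ) (<⇒≤ a<0) ≤-refl a≥0)) a<0)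

nonNeg-mono-re : a ≤ a′ → NonNeg (a + b φ) → NonNeg (a′ + b φ)
nonNeg-mono-re {a} {a′} {b} a≤a′ =
  nonNeg√5-mono {+ 2 * a + b} {+ 2 * a′ + b} {b} (+-monoˡ-≤ b (*-monoˡ-≤-nonNeg (+ 2) a≤a′))

-- Fibonacci numbers and powers of φ

fib-pos : ∀ k → 1 ℕ.≤ fib k
fib-pos zero = s≤s z≤n
fib-pos (suc zero) = s≤s z≤n
fib-pos (suc (suc k)) = ℕₚ.≤-trans (fib-pos k) (ℕₚ.m≤m+n (fib k) (fib (suc k)))

fib-< : ∀ k → fib k ℕ.< fib (2 ℕ.+ k)
fib-< k = ℕₚ.m<m+n (fib k) (fib-pos (suc k))

n≤fib : ∀ n → n ℕ.≤ fib n
n≤fib zero = z≤n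
n≤fib (suc zero) = s≤s z≤n
n≤fib (suc (suc n)) = ℕₚ.+-mono-≤ (fib-pos n) (n≤fib (suc n))

F : ℕ → ℤ
F k = + fib k

F-rec : ∀ k → F (2 ℕ.+ k) ≡ F k + F (suc k)
F-rec k = pos-+ (fib k) (fib (suc k))

mulφ^ : ℕ → ℤ[φ] → ℤ[φ]
mulφ^ zero u = u
mulφ^ (suc k) u = mulφ (mulφ^ k u)

nonNeg-mulφ^ : ∀ k u → NonNeg u ⇔ NonNeg (mulφ^ k u)
nonNeg-mulφ^ zero u = ⇔-refl
nonNeg-mulφ^ (suc k) u = ⇔-trans (nonNeg-mulφ^ k u) (nonNeg-mulφ (mulφ^ k u))

mulφ-linear : ∀ u v → mulφ (u -φ v) ≡ mulφ u -φ mulφ v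
mulφ-linear (a + b φ) (c + d φ) = cong (λ t → (b - d) + t φ) (ring a b c d)
  where
  ring : ∀ a b c d → a - c + (b - d) ≡ a + b - (c + d)
  ring = solve-∀

mulφ^-linear : ∀ k u v → mulφ^ k (u -φ v) ≡ mulφ^ k u -φ mulφ^ k v
mulφ^-linear zero u v = refl
mulφ^-linear (suc k) u v =
  trans (cong mulφ (mulφ^-linear k u v)) (mulφ-linear (mulφ^ k u) (mulφ^ k v))

-- φ^(k+2) = F (k+1) φ + F k, in the indexing F 0 = F 1 = 1
mulφ^-closed : ∀ k a b →
  mulφ^ (2 ℕ.+ k) (a + b φ) ≡ (a * F k + b * F (suc k)) + (a * F (suc k) + b * F (2 ℕ.+ k)) φ
mulφ^-closed zero a b = cong₂ _+_φ (ring a b) (ring′ a b)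
  where
  ring : ∀ a b → a + b ≡ a * + 1 + b * + 1
  ring = solve-∀
  ring′ : ∀ a b → b + (a + b) ≡ a * + 1 + b * + 2
  ring′ = solve-∀
mulφ^-closed (suc k) a b =
  trans (cong mulφ (mulφ^-closed k a b)) (cong (λ t → (a * q + b * r) + t φ) (begin
  (a * p + b * q) + (a * q + b * r) ≡⟨ ring a b p q r ⟩
  a * (p + q) + b * (q + r)         ≡⟨ cong₂ (λ s t → a * s + b * t) (F-rec k) (F-rec (suc k)) ⟨
  a * F (2 ℕ.+ k) + b * F (3 ℕ.+ k) ∎))
  where
  open ≡-Reasoning
  p = F k
  q = F (suc k)
  r = F (2 ℕ.+ k)
  ring : ∀ a b p q r → (a * p + b * q) + (a * q + b * r) ≡ a * (p + q) + b * (q + r)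
  ring = solve-∀

fibDet : ℕ → ℤ
fibDet k = F k * F (2 ℕ.+ k) - F (suc k) * F (suc k)

fibDet-suc : ∀ k → fibDet (suc k) ≡ - fibDet k
fibDet-suc k rewrite F-rec (suc k) | F-rec k = ring (F k) (F (suc k))
  where
  ring : ∀ p q → q * (q + (p + q)) - (p + q) * (p + q) ≡ - (p * (p + q) - q * q)
  ring = solve-∀

fibDet-even : ∀ j → fibDet (2 ℕ.* j) ≡ 1ℤ
fibDet-even zero = refl
fibDet-even (suc j) = begin
  fibDet (2 ℕ.* suc j)     ≡⟨ cong fibDet (ℕₚ.*-suc 2 j) ⟩
  fibDet (2 ℕ.+ 2 ℕ.* j)   ≡⟨ fibDet-suc (suc (2 ℕ.* j)) ⟩
  - fibDet (suc (2 ℕ.* j)) ≡⟨ cong -_ (fibDet-suc (2 ℕ.* j)) ⟩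
  - - fibDet (2 ℕ.* j)     ≡⟨ neg-involutive _ ⟩
  fibDet (2 ℕ.* j)         ≡⟨ fibDet-even j ⟩
  1ℤ                       ∎
  where open ≡-Reasoning

fibDet-odd : ∀ j → fibDet (suc (2 ℕ.* j)) ≡ - 1ℤ
fibDet-odd j = trans (fibDet-suc (2 ℕ.* j)) (cong -_ (fibDet-even j))

mulφ^-cassini : ∀ k u →
  im (mulφ^ (2 ℕ.+ k) u) * F k - re (mulφ^ (2 ℕ.+ k) u) * F (suc k) ≡ im u * fibDet k
mulφ^-cassini k (a + b φ) =
  trans (cong (λ v → im v * F k - re v * F (suc k)) (mulφ^-closed k a b))
        (ring a b (F k) (F (suc k)) (F (2 ℕ.+ k)))
  where
  ring : ∀ a b p q r → (a * q + b * r) * p - (a * p + b * q) * q ≡ b * (p * r - q * q)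
  ring = solve-∀

mulφ^-approximant : ∀ k → mulφ^ (2 ℕ.+ k) (φ* fib k - F (suc k)) ≡ 0ℤ + fibDet k φ
mulφ^-approximant k =
  trans (mulφ^-closed k _ _)
        (cong₂ _+_φ (ring (F k) (F (suc k))) (ring′ (F k) (F (suc k)) (F (2 ℕ.+ k))))
  where
  ring : ∀ p q → - q * p + p * q ≡ 0ℤ
  ring = solve-∀
  ring′ : ∀ p q r → - q * q + p * r ≡ p * r - q * q
  ring′ = solve-∀

nonNeg-approximant : ∀ k → NonNeg (φ* fib k - F (suc k)) ⇔ NonNeg (0ℤ + fibDet k φ)
nonNeg-approximant k =
  subst (λ v → NonNeg (φ* fib k - F (suc k)) ⇔ NonNeg v) (mulφ^-approximant k)
        (nonNeg-mulφ^ (2 ℕ.+ k) _)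

-- Fibonacci approximants

private variable
  c d p q : ℤ

small-combination-signs : 0ℤ ≤ p → 0ℤ ≤ q → 0ℤ < d * p - c * q → d * p - c * q < p + q →
                          (d ≤ 0ℤ × c < 0ℤ) ⊎ (1ℤ ≤ d × 0ℤ ≤ c)
small-combination-signs {p} {q} {d} {c} 0≤p 0≤q 0<n n<p+q with d ≤? 0ℤ | 0≤⊎<0 c
... | yes d≤0 | inj₂ c<0 = inj₁ (d≤0 , c<0)
... | no d≰0  | inj₁ 0≤c = inj₂ (1≤d , 0≤c)
  where 1≤d = i<j⇒suc[i]≤j (≰⇒> d≰0)
... | yes d≤0 | inj₁ 0≤c = ⊥-elim (<⇒≱ 0<n (+-mono-≤ dp≤0 (neg-mono-≤ (*-nonNeg 0≤c 0≤q))))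
  where dp≤0 = *-monoʳ-≤-nonNeg p {{nonNegative 0≤p}} d≤0
... | no d≰0  | inj₂ c<0 = ⊥-elim (<⇒≱ n<p+q (+-mono-≤ p≤dp q≤-cq))
  where
  p≤dp : p ≤ d * p
  p≤dp = subst (_≤ d * p) (*-identityˡ p)
                (*-monoʳ-≤-nonNeg p {{nonNegative 0≤p}} (i<j⇒suc[i]≤j (≰⇒> d≰0)))
  q≤-cq : q ≤ - (c * q)
  q≤-cq = subst₂ _≤_ (*-identityˡ q) (sym (neg-distribˡ-* c q))
                 (*-monoʳ-≤-nonNeg q {{nonNegative 0≤q}} (i<j⇒suc[i]≤j (neg-mono-< c<0)))

module _ (k : ℕ) {n : ℕ} (m : ℤ) (1≤n : 1 ℕ.≤ n) (n<fib : n ℕ.< fib (2 ℕ.+ k)) where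
  private
    w = φ* n - m
    t = φ* fib k - F (suc k)
    s = mulφ^ (2 ℕ.+ k) w

    scale : ∀ u → NonNeg u ⇔ NonNeg (mulφ^ (2 ℕ.+ k) u)
    scale = nonNeg-mulφ^ (2 ℕ.+ k)

    signs : d * F k - c * F (suc k) ≡ + n → (d ≤ 0ℤ × c < 0ℤ) ⊎ (1ℤ ≤ d × 0ℤ ≤ c)
    signs index = small-combination-signs (+≤+ z≤n) (+≤+ z≤n)
      (subst (0ℤ <_) (sym index) (+<+ 1≤n))
      (subst (_< _) (sym index) (subst (+ n <_) (F-rec k) (+<+ n<fib)))

    coords-φ⇒n≡fib : ∀ {d c} → d * F k - c * F (suc k) ≡ + n → d ≡ 1ℤ → c ≡ 0ℤ → n ≡ fib k
    coords-φ⇒n≡fib index refl refl = +-injective (trans (sym index) (ring (F k) (F (suc k))))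
      where
      ring : ∀ p q → 1ℤ * p - 0ℤ * q ≡ p
      ring = solve-∀

    scaled-differences : ∀ ε → fibDet k ≡ ε →
      mulφ^ (2 ℕ.+ k) (w -φ t) ≡ s -φ (0ℤ + ε φ) ×
      mulφ^ (2 ℕ.+ k) (t -φ w) ≡ (0ℤ + ε φ) -φ s
    scaled-differences ε refl =
      trans (mulφ^-linear (2 ℕ.+ k) w t) (cong (s -φ_) (mulφ^-approximant k)) ,
      trans (mulφ^-linear (2 ℕ.+ k) t w) (cong (_-φ s) (mulφ^-approximant k))

  approximant-below : fibDet k ≡ 1ℤ → NonNeg (φ* n - m) →
    (φ* fib k - F (suc k)) ≤φ (φ* n - m) × ((φ* n - m) ≤φ (φ* fib k - F (suc k)) → n ≡ fib k)
  approximant-below det≡1 w≥0 = by-signs (signs index)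
    where
    index : im s * F k - re s * F (suc k) ≡ + n
    index = trans (mulφ^-cassini k w) (trans (cong (+ n *_) det≡1) (*-identityʳ (+ n)))
    by-signs : (im s ≤ 0ℤ × re s < 0ℤ) ⊎ (1ℤ ≤ im s × 0ℤ ≤ re s) →
               t ≤φ w × (w ≤φ t → n ≡ fib k)
    by-signs (inj₁ (d≤0 , c<0)) =
      ⊥-elim (<-irrefl (proj₁ (nonNeg-nonPos-coords s (<⇒≤ c<0) d≤0 (to (scale w) w≥0))) c<0)
    by-signs (inj₂ (1≤d , 0≤c)) = below , unique
      where
      below : t ≤φ w
      below = from (scale (w -φ t)) (subst NonNeg (sym (proj₁ (scaled-differences 1ℤ det≡1)))
                (nonNeg-coords (s -φ (0ℤ + 1ℤ φ)) (i≤j⇒0≤j-i 0≤c) (i≤j⇒0≤j-i 1≤d)))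
      unique : w ≤φ t → n ≡ fib k
      unique t-w≥0 = coords-φ⇒n≡fib index (sym (i-j≡0⇒i≡j 1ℤ (im s) (proj₂ coords)))
                                         (sym (i-j≡0⇒i≡j 0ℤ (re s) (proj₁ coords)))
        where
        coords = nonNeg-nonPos-coords ((0ℤ + 1ℤ φ) -φ s) (i≤j⇒i-j≤0 0≤c) (i≤j⇒i-j≤0 1≤d)
                   (subst NonNeg (proj₂ (scaled-differences 1ℤ det≡1)) (to (scale (t -φ w)) t-w≥0))

  approximant-above : fibDet k ≡ - 1ℤ → ¬ NonNeg (φ* n - m) →
    (φ* n - m) ≤φ (φ* fib k - F (suc k)) × ((φ* fib k - F (suc k)) ≤φ (φ* n - m) → n ≡ fib k)
  approximant-above det≡-1 w≱0 = by-signs (signs index)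
    where
    index : - im s * F k - - re s * F (suc k) ≡ + n
    index = trans (ring (im s) (re s) (F k) (F (suc k)))
                  (trans (cong -_ (trans (mulφ^-cassini k w) (cong (+ n *_) det≡-1))) (ring′ (+ n)))
      where
      ring : ∀ d c p q → - d * p - - c * q ≡ - (d * p - c * q)
      ring = solve-∀
      ring′ : ∀ x → - (x * - 1ℤ) ≡ x
      ring′ = solve-∀
    by-signs : (- im s ≤ 0ℤ × - re s < 0ℤ) ⊎ (1ℤ ≤ - im s × 0ℤ ≤ - re s) →
               w ≤φ t × (t ≤φ w → n ≡ fib k)
    by-signs (inj₁ (-d≤0 , -c<0)) =
      ⊥-elim (w≱0 (from (scale w)
        (nonNeg-coords s (<⇒≤ (neg-cancel-< {re s} -c<0)) (neg-cancel-≤ {im s} -d≤0))))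
    by-signs (inj₂ (1≤-d , 0≤-c)) = above , unique
      where
      c≤0 : re s ≤ 0ℤ
      c≤0 = neg-cancel-≤ {0ℤ} 0≤-c
      d≤-1 : im s ≤ - 1ℤ
      d≤-1 = neg-cancel-≤ { - 1ℤ} 1≤-d
      above : w ≤φ t
      above = from (scale (t -φ w)) (subst NonNeg (sym (proj₂ (scaled-differences (- 1ℤ) det≡-1)))
                (nonNeg-coords ((0ℤ + - 1ℤ φ) -φ s) (i≤j⇒0≤j-i c≤0) (i≤j⇒0≤j-i d≤-1)))
      unique : t ≤φ w → n ≡ fib k
      unique w-t≥0 = coords-φ⇒n≡fib index (cong -_ (i-j≡0⇒i≡j (im s) (- 1ℤ) (proj₂ coords)))
                                         (cong -_ (i-j≡0⇒i≡j (re s) 0ℤ (proj₁ coords)))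
        where
        coords = nonNeg-nonPos-coords (s -φ (0ℤ + - 1ℤ φ)) (i≤j⇒i-j≤0 c≤0) (i≤j⇒i-j≤0 d≤-1)
                   (subst NonNeg (proj₁ (scaled-differences (- 1ℤ) det≡-1)) (to (scale (w -φ t)) w-t≥0))

bracket : (s : ℕ → ℕ) {a : ℕ} (J : ℕ) → s 0 ℕ.≤ a → a ℕ.< s J →
          ∃[ j ] (s j ℕ.≤ a × a ℕ.< s (suc j))
bracket s zero s0≤a a<s0 = ⊥-elim (ℕₚ.<⇒≱ a<s0 s0≤a)
bracket s {a} (suc J) s0≤a a<sJ+1 with s J ℕₚ.≤? a
... | yes sJ≤a = J , sJ≤a , a<sJ+1
... | no sJ≰a = bracket s J s0≤a (ℕₚ.≰⇒> sJ≰a)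

even-index-bracket : ∀ {a} → 1 ℕ.≤ a →
                     ∃[ j ] (fib (2 ℕ.* j) ℕ.≤ a × a ℕ.< fib (2 ℕ.+ 2 ℕ.* j))
even-index-bracket {a} 1≤a with bracket (λ j → fib (2 ℕ.* j)) (suc a) 1≤a a<fib
  where a<fib = ℕₚ.<-≤-trans (ℕₚ.n<1+n a) (ℕₚ.≤-trans (ℕₚ.m≤n*m (suc a) 2) (n≤fib _))
... | j , fib≤a , a<fib = j , fib≤a , subst (λ i → a ℕ.< fib i) (ℕₚ.*-suc 2 j) a<fib

odd-index-bracket : ∀ {a} → 1 ℕ.≤ a →
                    ∃[ j ] (fib (suc (2 ℕ.* j)) ℕ.≤ a × a ℕ.< fib (2 ℕ.+ suc (2 ℕ.* j)))
odd-index-bracket {a} 1≤a with bracket (λ j → fib (suc (2 ℕ.* j))) (suc a) 1≤a a<fib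
  where
  a<fib = ℕₚ.<-≤-trans (ℕₚ.n<1+n a)
            (ℕₚ.≤-trans (ℕₚ.m≤n*m (suc a) 2) (ℕₚ.≤-trans (ℕₚ.n≤1+n _) (n≤fib _)))
... | j , fib≤a , a<fib = j , fib≤a , subst (λ i → a ℕ.< fib (suc i)) (ℕₚ.*-suc 2 j) a<fib

-- Floors

φ*-≤φ-cancel : ∀ n {m m′} → (φ* n - m) ≤φ (φ* n - m′) → m′ ≤ m
φ*-≤φ-cancel n {m} {m′} m≤m′ = neg-cancel-≤ (0≤i-j⇒j≤i (nonNeg-rational
  (subst NonNeg (cong (λ i → (- m′ - - m) + i φ) (+-inverseʳ (+ n))) m≤m′)))

φ*-shift : ∀ a n M m → (φ* a - (M + 1ℤ)) -φ (φ* n - (m + 1ℤ)) ≡ (φ* a - M) -φ (φ* n - m)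
φ*-shift a n M m = cong (λ r → r + (+ a - + n) φ) (ring M m)
  where
  ring : ∀ M m → - (M + 1ℤ) - - (m + 1ℤ) ≡ - M - - m
  ring = solve-∀

module _ (fl : ℕ → ℤ) (isFloor : ∀ n → IsFloorφ n (fl n)) where

  floor-lower : ∀ n → NonNeg (φ* n - fl n)
  floor-lower n =
    subst NonNeg (cong₂ _+_φ (+-identityʳ (- fl n)) (+-identityʳ (+ n))) (proj₁ (isFloor n))

  floor-upper : ∀ n → ¬ NonNeg (φ* n - (fl n + 1ℤ))
  floor-upper n w≥1 =
    proj₂ (proj₂ (isFloor n)) (subst NonNeg (cong₂ _+_φ (ring (fl n)) (sym (+-identityʳ (+ n)))) w≥1)
    where
    ring : ∀ m → - (m + 1ℤ) ≡ - m - 1ℤ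
    ring = solve-∀

  floor-greatest : ∀ {m} n → NonNeg (φ* n - m) → m ≤ fl n
  floor-greatest {m} n w≥0 with m ≤? fl n
  ... | yes m≤fl = m≤fl
  ... | no m≰fl = ⊥-elim (floor-upper n (nonNeg-mono-re (neg-mono-≤ fl+1≤m) w≥0))
    where
    fl+1≤m : fl n + 1ℤ ≤ m
    fl+1≤m = subst (_≤ m) (+-comm 1ℤ (fl n)) (i<j⇒suc[i]≤j (≰⇒> m≰fl))

  floor-fib-even : ∀ k → fibDet k ≡ 1ℤ → fl (fib k) ≡ F (suc k)
  floor-fib-even k det≡1 = ≤-antisym M≤b b≤M
    where
    M = fl (fib k)
    M≤b : M ≤ F (suc k)
    M≤b = φ*-≤φ-cancel (fib k)
            (proj₁ (approximant-below k M (fib-pos k) (fib-< k) det≡1 (floor-lower (fib k))))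
    b≤M : F (suc k) ≤ M
    b≤M = floor-greatest (fib k) (from (nonNeg-approximant k)
            (nonNeg-coords (0ℤ + fibDet k φ) ≤-refl (subst (0ℤ ≤_) (sym det≡1) (+≤+ z≤n))))

  floor-fib-odd : ∀ k → fibDet k ≡ - 1ℤ → fl (fib k) + 1ℤ ≡ F (suc k)
  floor-fib-odd k det≡-1 = ≤-antisym M+1≤b b≤M+1
    where
    M = fl (fib k)
    b≤M+1 : F (suc k) ≤ M + 1ℤ
    b≤M+1 = φ*-≤φ-cancel (fib k)
              (proj₁ (approximant-above k (M + 1ℤ) (fib-pos k) (fib-< k) det≡-1 (floor-upper (fib k))))
    M+1≤b : M + 1ℤ ≤ F (suc k)
    M+1≤b with F (suc k) ≤? M
    ... | no b≰M = subst (_≤ F (suc k)) (+-comm 1ℤ M) (i<j⇒suc[i]≤j (≰⇒> b≰M))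
    ... | yes b≤M = ⊥-elim (¬nonNeg-negφ (subst (λ ε → NonNeg (0ℤ + ε φ)) det≡-1
                      (to (nonNeg-approximant k) (nonNeg-mono-re (neg-mono-≤ b≤M) (floor-lower (fib k))))))
      where
      ¬nonNeg-negφ : ¬ NonNeg (0ℤ + - 1ℤ φ)
      ¬nonNeg-negφ (inj₁ (() , _))
      ¬nonNeg-negφ (inj₂ (inj₁ ((() , _) , _)))
      ¬nonNeg-negφ (inj₂ (inj₂ ((_ , ()) , _)))

  fracφ-fib-min : ∀ k {n} → fibDet k ≡ 1ℤ → 1 ℕ.≤ n → n ℕ.< fib (2 ℕ.+ k) →
    fracφ fl (fib k) ≤φ fracφ fl n × (fracφ fl n ≤φ fracφ fl (fib k) → n ≡ fib k)
  fracφ-fib-min k {n} det≡1 1≤n n<fib =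
    subst (λ M → (φ* fib k - M) ≤φ fracφ fl n × (fracφ fl n ≤φ (φ* fib k - M) → n ≡ fib k))
          (sym (floor-fib-even k det≡1))
          (approximant-below k (fl n) 1≤n n<fib det≡1 (floor-lower n))

  fracφ-fib-max : ∀ k {n} → fibDet k ≡ - 1ℤ → 1 ℕ.≤ n → n ℕ.< fib (2 ℕ.+ k) →
    fracφ fl n ≤φ fracφ fl (fib k) × (fracφ fl (fib k) ≤φ fracφ fl n → n ≡ fib k)
  fracφ-fib-max k {n} det≡-1 1≤n n<fib = below , λ above → unique (unshift above)
    where
    M = fl (fib k)
    m = fl n
    b≡M+1 : F (suc k) ≡ M + 1ℤ
    b≡M+1 = sym (floor-fib-odd k det≡-1)
    ceiling = approximant-above k (m + 1ℤ) 1≤n n<fib det≡-1 (floor-upper n)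
    unique = proj₂ ceiling
    below : fracφ fl n ≤φ fracφ fl (fib k)
    below = subst NonNeg (φ*-shift (fib k) n M m)
              (subst (λ b → NonNeg ((φ* fib k - b) -φ (φ* n - (m + 1ℤ)))) b≡M+1 (proj₁ ceiling))
    unshift : fracφ fl (fib k) ≤φ fracφ fl n → (φ* fib k - F (suc k)) ≤φ (φ* n - (m + 1ℤ))
    unshift above = subst (λ b → NonNeg ((φ* n - (m + 1ℤ)) -φ (φ* fib k - b))) (sym b≡M+1)
                      (subst NonNeg (sym (φ*-shift n (fib k) m M)) above)

  fib-even⇒min : ∀ j → IsMinFrac fl (fib (2 ℕ.* j))
  fib-even⇒min j = fib-pos k , λ n 1≤n n≤fib →
    proj₁ (fracφ-fib-min k (fibDet-even j) 1≤n (ℕₚ.≤-<-trans n≤fib (fib-< k)))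
    where k = 2 ℕ.* j

  fib-odd⇒max : ∀ j → IsMaxFrac fl (fib (suc (2 ℕ.* j)))
  fib-odd⇒max j = fib-pos k , λ n 1≤n n≤fib →
    proj₁ (fracφ-fib-max k (fibDet-odd j) 1≤n (ℕₚ.≤-<-trans n≤fib (fib-< k)))
    where k = suc (2 ℕ.* j)

  min⇒fib-even : ∀ {a} → IsMinFrac fl a → EvenIndexFib a
  min⇒fib-even (1≤a , isMin) with even-index-bracket 1≤a
  ... | j , fib≤a , a<fib =
    j , proj₂ (fracφ-fib-min k (fibDet-even j) 1≤a a<fib) (isMin (fib k) (fib-pos k) fib≤a)
    where k = 2 ℕ.* j

  max⇒fib-odd : ∀ {a} → IsMaxFrac fl a → OddIndexFib a
  max⇒fib-odd (1≤a , isMax) with odd-index-bracket 1≤a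
  ... | j , fib≤a , a<fib =
    j , proj₂ (fracφ-fib-max k (fibDet-odd j) 1≤a a<fib) (isMax (fib k) (fib-pos k) fib≤a)
    where k = suc (2 ℕ.* j)

lemma3p2 : (fl : ℕ → ℤ) → (∀ n → IsFloorφ n (fl n)) → (a : ℕ) →
    (EvenIndexFib a ⇔ IsMinFrac fl a) × (OddIndexFib a ⇔ IsMaxFrac fl a)
lemma3p2 fl isFloor a =
  mk⇔ (λ { (j , refl) → fib-even⇒min fl isFloor j }) (min⇒fib-even fl isFloor) ,
  mk⇔ (λ { (j , refl) → fib-odd⇒max fl isFloor j }) (max⇒fib-odd fl isFloor)
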